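{- Fix an integer $k\ge 2$. There are infinitely many positive integers $N$ such that the open interval $(N^k,(N+1)^k)$ contains at least $M$ $k$-full integers, where $$M\ge\sqrt{\Big(\frac{k}{2(k+1)}+o(1)\Big)\frac{\log N}{\log\log N}}$$ with $o(1)\to 0$ as $N\to\infty$.
   Context: A positive integer $n$ is $k$-full if for every prime $q$ dividing $n$ also $q^k$ divides $n$. -}

module Defs where

open import Data.Nat as ℕ using (ℕ; zero; suc; _^_; _<_)
open import Data.Nat.Divisibility using (_∣_)
open import Data.Nat.Primality using (Prime)
open import Data.Integer as ℤ using (ℤ)
open import Data.Rational as ℚ using (ℚ; 0ℚ; 1ℚ)
open import Data.Vec using (Vec; []; _∷_)
open import Data.Vec.Relation.Unary.All using (All)
open import Data.List.Relation.Unary.Linked using (Linked)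
open import Data.Vec using (toList)

KFull : ℕ → ℕ → Set
KFull k n = 0 < n × (∀ q → Prime q → q ∣ n → q ^ k ∣ n)
  where open import Data.Product using (_×_)

ℕ→ℚ : ℕ → ℚ
ℕ→ℚ n = ℤ.+ n ℚ./ 1

_^ℚ_ : ℚ → ℕ → ℚ
r ^ℚ zero = 1ℚ
r ^ℚ suc n = r ℚ.* (r ^ℚ n)

expTerm : ℚ → ℕ → ℚ
expTerm r zero = 1ℚ
expTerm r (suc j) = expTerm r j ℚ.* (r ℚ.* (ℤ.+ 1 ℚ./ suc j))

expPartial : ℚ → ℕ → ℚ
expPartial r zero = 1ℚ
expPartial r (suc n) = expPartial r n ℚ.+ expTerm r (suc n)

-- LogBound p q N M  encodes, for N ≥ 3, the real inequality
--   M ≥ sqrt( (p/q) · log N / log log N ),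
-- via the exact equivalent (for p ≥ 1, q ≥ 1, N ≥ 3):
--   exp( N ^ (p / (q·M²)) ) ≤ N
-- i.e. for every rational r ≥ 0 with r ^ (q·M²) ≤ N ^ p, and every n,
-- the partial exponential sum Σ_{j≤n} r^j/j! is ≤ N.
LogBound : ℕ → ℕ → ℕ → ℕ → Set
LogBound p q N M =
  ∀ (r : ℚ) → 0ℚ ℚ.≤ r → (r ^ℚ (q ℕ.* M ℕ.* M)) ℚ.≤ ℕ→ℚ (N ^ p) →
  ∀ (n : ℕ) → expPartial r n ℚ.≤ ℕ→ℚ N

KFullInGap : ℕ → ℕ → (M : ℕ) → Vec ℕ M → Set
KFullInGap k N M v =
  Linked ℕ._<_ (toList v) ×
  All (λ m → N ^ k < m × m < suc N ^ k × KFull k m) v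
  where open import Data.Product using (_×_)

module Submission where

-- Take primes p 0, …, p r and, for each subset S of the first r of them, the k-full number
-- d S = p r ^ (k + 1) · ∏_{i ∈ S} p i ^ (k + 1). Comparing exponents modulo k at a prime where two
-- subsets differ shows that the numbers m ^ k · d S (m ≥ 1) are pairwise distinct and never k-th
-- powers. With d S ≤ B ^ k, Dirichlet's box principle gives a multiple N ≤ T · (2 B) ^ (2 ^ r) of a
-- prescribed T such that every N / (d S) ^ (1/k) is within 1 / (2 B) of an integer m S; then
-- m S ^ k · d S lies strictly between (N - 1) ^ k and (N + 1) ^ k and differs from N ^ k, so one of
-- the two gaps next to N ^ k contains K ≥ 2 ^ (r - 1) of these numbers. Taking the primes below
-- 2 ^ ((r + 2)²) makes N ≤ 2 ^ (2 K²), so N ^ (p / (q K²)) < 2 as 2 p < q, and exp 2 < 8 ≤ N.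

open import Defs
open import Data.Nat using (ℕ; suc; _*_; _<_; _≤_)
open import Data.Product using (Σ; _×_)
open import Data.Vec using (Vec)

open import Data.Bool using (Bool; true; false)
open import Data.Fin using (Fin; toℕ; fromℕ<)
import Data.Fin.Properties as Fin
import Data.Integer as ℤ
import Data.Integer.Properties as ℤ
open import Data.List using (List; []; _∷_; _++_; length; filter; cartesianProductWith; map)
open import Data.List.Properties using (length-++; length-map)
open import Data.List.Relation.Binary.Permutation.Propositional using (↭⇒↭ₛ; ↭-sym)
open import Data.List.Relation.Binary.Permutation.Propositional.Properties using (All-resp-↭; ↭-length)
import Data.List.Relation.Binary.Permutation.Setoid.Properties as ↭ₛ
open import Data.List.Relation.Unary.All using (All; []; _∷_)
import Data.List.Relation.Unary.All as All
import Data.List.Relation.Unary.All.Properties as All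
open import Data.List.Relation.Unary.AllPairs using ([]; _∷_)
import Data.List.Relation.Unary.AllPairs as AllPairs
import Data.List.Relation.Unary.AllPairs.Properties as AllPairs
open import Data.List.Relation.Unary.Linked using (Linked)
open import Data.List.Relation.Unary.Linked.Properties using (AllPairs⇒Linked; Linked⇒AllPairs)
open import Data.List.Relation.Unary.Unique.Propositional using (Unique)
import Data.List.Relation.Unary.Unique.Propositional.Properties as Unique
open import Data.Nat
  using (zero; _+_; _^_; _∸_; _⊔_; _!; ∣_-_∣; pred; _<?_; z≤n; s≤s; NonZero; >-nonZero; >-nonZero⁻¹; nonTrivial⇒n>1)
import Data.Nat.Coprimality as Coprime
open import Data.Nat.Divisibility
open import Data.Nat.DivMod
open import Data.Nat.Induction using (<-rec)
open import Data.Nat.ListAction using (product)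
open import Data.Nat.Primality
open import Data.Nat.Primality.Factorisation using (factorise; PrimeFactorisation)
open import Data.Nat.Properties
open import Data.Nat.Tactic.RingSolver using (solve-∀)
open import Data.List.Sort ≤-decTotalOrder using (sort; sort-↭; sort-↗)
open import Data.Product using (_,_; proj₁; proj₂; ∃; ∃₂)
open import Data.Rational as ℚ using (ℚ; 0ℚ; 1ℚ; mkℚ; *≤*)
import Data.Rational.Properties as ℚ
open import Data.Sum using (_⊎_; inj₁; inj₂)
open import Data.Unit using (tt)
open import Data.Vec using ([]; _∷_; fromList)
open import Data.Vec.Properties using (∷-injective; toList∘fromList)
import Data.Vec.Relation.Unary.All.Properties as VecAll
open import Function using (_∘_)
open import Relation.Binary.Definitions using (tri<; tri≈; tri>)
open import Relation.Binary.PropositionalEquality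
open import Relation.Nullary using (¬_; yes; no; contradiction; Dec)
open import Relation.Nullary.Decidable using (_×-dec_)
open import Relation.Unary using (Decidable)
open import Relation.Unary.Properties using (∁?)

n<2^n : ∀ n → n < 2 ^ n
n<2^n zero    = s≤s z≤n
n<2^n (suc n) = ≤-<-trans (n<2^n n) (^-monoʳ-< 2 (s≤s (s≤s z≤n)) (n<1+n n))

n!≤2^[n*n] : ∀ n → n ! ≤ 2 ^ (n * n)
n!≤2^[n*n] zero    = ≤-refl
n!≤2^[n*n] (suc n) = begin
  suc n * n !             ≤⟨ *-mono-≤ (<⇒≤ (n<2^n (suc n))) (n!≤2^[n*n] n) ⟩
  2 ^ suc n * 2 ^ (n * n) ≡⟨ ^-distribˡ-+-* 2 (suc n) (n * n) ⟨
  2 ^ (suc n + n * n)     ≤⟨ ^-monoʳ-≤ 2 (+-monoʳ-≤ (suc n) (*-monoʳ-≤ n (n≤1+n n))) ⟩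
  2 ^ (suc n + n * suc n) ∎
  where open ≤-Reasoning

^-distribʳ-* : ∀ a b n → (a * b) ^ n ≡ a ^ n * b ^ n
^-distribʳ-* a b zero    = refl
^-distribʳ-* a b (suc n) = trans (cong (a * b *_) (^-distribʳ-* a b n)) (interchange a b (a ^ n) (b ^ n))
  where
  interchange : ∀ a b c d → a * b * (c * d) ≡ a * c * (b * d)
  interchange = solve-∀

2*[16+v]³≤2^[13+v] : ∀ v → 2 * ((16 + v) * (16 + v) * (16 + v)) ≤ 2 ^ (13 + v)
2*[16+v]³≤2^[13+v] zero    = ≤-refl
2*[16+v]³≤2^[13+v] (suc v) = begin
  2 * ((17 + v) * (17 + v) * (17 + v))        ≤⟨ *-monoʳ-≤ 2 (m≤m+n ((17 + v) * (17 + v) * (17 + v)) slack) ⟩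
  2 * ((17 + v) * (17 + v) * (17 + v) + slack) ≡⟨ cong (2 *_) (cube-step v) ⟩
  2 * (2 * ((16 + v) * (16 + v) * (16 + v)))  ≤⟨ *-monoʳ-≤ 2 (2*[16+v]³≤2^[13+v] v) ⟩
  2 * 2 ^ (13 + v)                            ∎
  where
  open ≤-Reasoning
  slack = v * v * v + 45 * v * v + 669 * v + 3279
  cube-step : ∀ v → (17 + v) * (17 + v) * (17 + v) + (v * v * v + 45 * v * v + 669 * v + 3279)
                    ≡ 2 * ((16 + v) * (16 + v) * (16 + v))
  cube-step = solve-∀

2*[3+x]³≤2^x : ∀ {x} → 13 ≤ x → 2 * ((3 + x) * (3 + x) * (3 + x)) ≤ 2 ^ x
2*[3+x]³≤2^x {x} 13≤x = subst (λ y → 2 * ((3 + y) * (3 + y) * (3 + y)) ≤ 2 ^ y) (m+[n∸m]≡n 13≤x)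
                               (2*[16+v]³≤2^[13+v] (x ∸ 13))

-- Primes and k-full numbers

prime⇒1< : ∀ {p} → Prime p → 1 < p
prime⇒1< {p} pp = nonTrivial⇒n>1 p {{prime⇒nonTrivial pp}}


prime∤1 : ∀ {p} → Prime p → ¬ p ∣ 1
prime∤1 pp p∣1 = <⇒≢ (prime⇒1< pp) (sym (∣1⇒≡1 p∣1))

prime∣^⇒∣ : ∀ {p m} n → Prime p → p ∣ m ^ n → p ∣ m
prime∣^⇒∣ zero    pp p∣1 = contradiction p∣1 (prime∤1 pp)
prime∣^⇒∣ {m = m} (suc n) pp p∣mmⁿ with euclidsLemma m (m ^ n) pp p∣mmⁿ
... | inj₁ p∣m  = p∣m
... | inj₂ p∣mⁿ = prime∣^⇒∣ n pp p∣mⁿ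

prime∣^*⇒∣ : ∀ {p m w} n → Prime p → ¬ p ∣ w → p ∣ m ^ n * w → p ∣ m
prime∣^*⇒∣ {m = m} {w} n pp p∤w p∣mⁿw with euclidsLemma (m ^ n) w pp p∣mⁿw
... | inj₁ p∣mⁿ = prime∣^⇒∣ n pp p∣mⁿ
... | inj₂ p∣w  = contradiction p∣w p∤w

prime∣prime⇒≡ : ∀ {p q} → Prime p → Prime q → p ∣ q → p ≡ q
prime∣prime⇒≡ pp pq p∣q with prime⇒irreducible pq p∣q
... | inj₁ refl = contradiction (prime⇒1< pp) (<-irrefl refl)
... | inj₂ p≡q  = p≡q

^-pres-∣ : ∀ {a b} n → a ∣ b → a ^ n ∣ b ^ n
^-pres-∣ zero    _   = ∣-refl
^-pres-∣ (suc n) a∣b = *-pres-∣ a∣b (^-pres-∣ n a∣b)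

^-∣-^ : ∀ m {i j} → i ≤ j → m ^ i ∣ m ^ j
^-∣-^ m {i} {j} i≤j = divides (m ^ (j ∸ i)) (begin
  m ^ j               ≡⟨ cong (m ^_) (m∸n+n≡m i≤j) ⟨
  m ^ (j ∸ i + i)     ≡⟨ ^-distribˡ-+-* m (j ∸ i) i ⟩
  m ^ (j ∸ i) * m ^ i ∎)
  where open ≡-Reasoning

module _ {k : ℕ} where

  KFull-* : ∀ {a b} → KFull k a → KFull k b → KFull k (a * b)
  KFull-* {a} {b} (0<a , full-a) (0<b , full-b) = *-mono-≤ 0<a 0<b , full
    where
    full : ∀ q → Prime q → q ∣ a * b → q ^ k ∣ a * b
    full q pq q∣ab with euclidsLemma a b pq q∣ab
    ... | inj₁ q∣a = ∣m⇒∣m*n b (full-a q pq q∣a)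
    ... | inj₂ q∣b = ∣n⇒∣m*n a (full-b q pq q∣b)

  KFull-^ : ∀ {m e} → 0 < m → k ≤ e → KFull k (m ^ e)
  KFull-^ {m} {e} 0<m k≤e = m^n>0 m {{>-nonZero 0<m}} e , λ q pq q∣mᵉ →
    ∣-trans (^-pres-∣ k (prime∣^⇒∣ e pq q∣mᵉ)) (^-∣-^ m k≤e)

  KFull-1 : KFull k 1
  KFull-1 = s≤s z≤n , λ q pq q∣1 → contradiction q∣1 (prime∤1 pq)

DistinctModPowers : ℕ → ℕ → ℕ → Set
DistinctModPowers k d d′ = ∀ {m n} → 1 ≤ m → 1 ≤ n → m ^ k * d ≢ n ^ k * d′

DistinctModPowers-sym : ∀ {k d d′} → DistinctModPowers k d d′ → DistinctModPowers k d′ d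
DistinctModPowers-sym distinct 1≤m 1≤n = distinct 1≤n 1≤m ∘ sym

-- The exponent of p in m ^ k * (p * w) is 1 modulo k, in n ^ k * w′ it is 0; we descend on m.
module _ {k p w w′ : ℕ} (2≤k : 2 ≤ k) (pp : Prime p) (p∤w : ¬ p ∣ w) (p∤w′ : ¬ p ∣ w′) where

  private
    instance
      p≢0 : NonZero p
      p≢0 = >-nonZero (<-trans (s≤s z≤n) (prime⇒1< pp))
      pᵏ≢0 : NonZero (p ^ k)
      pᵏ≢0 = m^n≢0 p k

    p²∣pᵏ : p * p ∣ p ^ k
    p²∣pᵏ = subst (_∣ p ^ k) (cong (p *_) (*-identityʳ p)) (^-∣-^ p 2≤k)

    ^-pull : ∀ m x → (m * p) ^ k * x ≡ p ^ k * (m ^ k * x)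
    ^-pull m x = trans (cong (_* x) (^-distribʳ-* m p k)) (swap (m ^ k) (p ^ k) x)
      where
      swap : ∀ a b c → a * b * c ≡ b * (a * c)
      swap = solve-∀

    descent : ∀ m → 1 ≤ m → ∀ n → m ^ k * (p * w) ≢ n ^ k * w′
    descent = <-rec _ step
      where
      step : ∀ m → (∀ {m₁} → m₁ < m → 1 ≤ m₁ → ∀ n → m₁ ^ k * (p * w) ≢ n ^ k * w′) →
             1 ≤ m → ∀ n → m ^ k * (p * w) ≢ n ^ k * w′
      step m rec 1≤m n eq = rec m₁<m 1≤m₁ n₁ (*-cancelˡ-≡ _ _ (p ^ k) (begin
        p ^ k * (m₁ ^ k * (p * w)) ≡⟨ ^-pull m₁ (p * w) ⟨
        (m₁ * p) ^ k * (p * w)     ≡⟨ cong (λ x → x ^ k * (p * w)) m≡m₁p ⟨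
        m ^ k * (p * w)            ≡⟨ eq ⟩
        n ^ k * w′                 ≡⟨ cong (λ x → x ^ k * w′) n≡n₁p ⟩
        (n₁ * p) ^ k * w′          ≡⟨ ^-pull n₁ w′ ⟩
        p ^ k * (n₁ ^ k * w′)      ∎))
        where
        open ≡-Reasoning
        p∣n : p ∣ n
        p∣n = prime∣^*⇒∣ k pp p∤w′ (subst (p ∣_) eq (∣n⇒∣m*n (m ^ k) (∣m⇒∣m*n w ∣-refl)))
        n₁ = quotient p∣n
        n≡n₁p : n ≡ n₁ * p
        n≡n₁p = _∣_.equality p∣n
        p²∣pmᵏw : p * p ∣ p * (m ^ k * w)
        p²∣pmᵏw = subst (p * p ∣_) eq′ (∣m⇒∣m*n _ p²∣pᵏ)
          where
          eq′ : p ^ k * (n₁ ^ k * w′) ≡ p * (m ^ k * w)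
          eq′ = begin
            p ^ k * (n₁ ^ k * w′) ≡⟨ ^-pull n₁ w′ ⟨
            (n₁ * p) ^ k * w′     ≡⟨ cong (λ x → x ^ k * w′) n≡n₁p ⟨
            n ^ k * w′            ≡⟨ eq ⟨
            m ^ k * (p * w)       ≡⟨ rearrange (m ^ k) p w ⟩
            p * (m ^ k * w)       ∎
            where
            rearrange : ∀ a b c → a * (b * c) ≡ b * (a * c)
            rearrange = solve-∀
        p∣m : p ∣ m
        p∣m = prime∣^*⇒∣ k pp p∤w (*-cancelˡ-∣ p p²∣pmᵏw)
        m₁ = quotient p∣m
        m≡m₁p : m ≡ m₁ * p
        m≡m₁p = _∣_.equality p∣m
        1≤m₁ : 1 ≤ m₁
        1≤m₁ = n≢0⇒n>0 λ m₁≡0 → <⇒≢ 1≤m (sym (trans m≡m₁p (cong (_* p) m₁≡0)))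
        m₁<m : m₁ < m
        m₁<m = subst (m₁ <_) (sym m≡m₁p) (m<m*n m₁ p {{>-nonZero 1≤m₁}} (prime⇒1< pp))

  DistinctModPowers-prime : DistinctModPowers k (p ^ suc k * w) w′
  DistinctModPowers-prime {m} {n} 1≤m _ eq = descent (m * p) 1≤mp n (begin
    (m * p) ^ k * (p * w)   ≡⟨ cong (_* (p * w)) (^-distribʳ-* m p k) ⟩
    m ^ k * p ^ k * (p * w) ≡⟨ rearrange (m ^ k) (p ^ k) p w ⟩
    m ^ k * (p ^ suc k * w) ≡⟨ eq ⟩
    n ^ k * w′              ∎)
    where
    open ≡-Reasoning
    rearrange : ∀ a b c d → a * b * (c * d) ≡ a * (c * b * d)
    rearrange = solve-∀
    1≤mp : 1 ≤ m * p
    1≤mp = *-mono-≤ 1≤m (<⇒≤ (prime⇒1< pp))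

module PrimeProducts (k : ℕ) (p : ℕ → ℕ) (p-prime : ∀ i → Prime (p i)) where

  primeProduct : ∀ {n} → Vec Bool n → ℕ
  primeProduct []                   = 1
  primeProduct {suc n} (true  ∷ bs) = p n ^ suc k * primeProduct bs
  primeProduct {suc n} (false ∷ bs) = primeProduct bs

  private
    instance
      p≢0 : ∀ {i} → NonZero (p i)
      p≢0 {i} = >-nonZero (<-trans (s≤s z≤n) (prime⇒1< (p-prime i)))

  primeProduct-KFull : ∀ {n} (bs : Vec Bool n) → KFull k (primeProduct bs)
  primeProduct-KFull []           = KFull-1 {k}
  primeProduct-KFull (true  ∷ bs) = KFull-* {k} (KFull-^ (>-nonZero⁻¹ _) (n≤1+n k)) (primeProduct-KFull bs)
  primeProduct-KFull (false ∷ bs) = primeProduct-KFull bs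

  primeProduct-∤ : ∀ {n q} → Prime q → (∀ {i} → i < n → p i ≢ q) →
                   (bs : Vec Bool n) → ¬ q ∣ primeProduct bs
  primeProduct-∤ pq _ [] = prime∤1 pq
  primeProduct-∤ {suc n} pq p≢q (true ∷ bs) q∣ with euclidsLemma _ _ pq q∣
  ... | inj₁ q∣pⁿ⁺¹ = p≢q ≤-refl (sym (prime∣prime⇒≡ pq (p-prime n) (prime∣^⇒∣ (suc k) pq q∣pⁿ⁺¹)))
  ... | inj₂ q∣rest = primeProduct-∤ pq (p≢q ∘ m≤n⇒m≤1+n) bs q∣rest
  primeProduct-∤ pq p≢q (false ∷ bs) = primeProduct-∤ pq (p≢q ∘ m≤n⇒m≤1+n) bs

  primeProduct-≤ : ∀ {n A} .{{_ : NonZero A}} → (∀ {i} → i < n → p i ≤ A) →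
                   (bs : Vec Bool n) → primeProduct bs ≤ A ^ (suc k * n)
  primeProduct-≤ {A = A} _ [] = m^n>0 A (suc k * 0)
  primeProduct-≤ {suc n} {A} p≤A (true ∷ bs) = begin
    p n ^ suc k * primeProduct bs   ≤⟨ *-mono-≤ (^-monoˡ-≤ (suc k) (p≤A ≤-refl)) (primeProduct-≤ (p≤A ∘ m≤n⇒m≤1+n) bs) ⟩
    A ^ suc k * A ^ (suc k * n)     ≡⟨ ^-distribˡ-+-* A (suc k) (suc k * n) ⟨
    A ^ (suc k + suc k * n)         ≡⟨ cong (A ^_) (*-suc (suc k) n) ⟨
    A ^ (suc k * suc n)             ∎
    where open ≤-Reasoning
  primeProduct-≤ {suc n} {A} p≤A (false ∷ bs) = ≤-trans (primeProduct-≤ (p≤A ∘ m≤n⇒m≤1+n) bs)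
    (^-monoʳ-≤ A (*-monoʳ-≤ (suc k) (n≤1+n n)))

  primeProduct-distinct : 2 ≤ k → ∀ {n} → (∀ {i j} → i < j → j < n → p i ≢ p j) →
                          {bs bs′ : Vec Bool n} → bs ≢ bs′ →
                          DistinctModPowers k (primeProduct bs) (primeProduct bs′)
  primeProduct-distinct _ _ {[]} {[]} []≢[] = contradiction refl []≢[]
  primeProduct-distinct 2≤k {suc n} distinct {true ∷ bs} {true ∷ bs′} ne {m} {m′} 1≤m 1≤m′ eq =
    primeProduct-distinct 2≤k (λ i<j j<n → distinct i<j (m≤n⇒m≤1+n j<n)) (ne ∘ cong (true ∷_)) 1≤m 1≤m′
      (*-cancelˡ-≡ _ _ P {{m^n≢0 (p n) (suc k)}}
        (trans (rearrange P (m ^ k) _) (trans eq (rearrange (m′ ^ k) P _))))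
    where
    P = p n ^ suc k
    rearrange : ∀ a b c → a * (b * c) ≡ b * (a * c)
    rearrange = solve-∀
  primeProduct-distinct 2≤k {suc n} distinct {false ∷ bs} {false ∷ bs′} ne =
    primeProduct-distinct 2≤k (λ i<j j<n → distinct i<j (m≤n⇒m≤1+n j<n)) (ne ∘ cong (false ∷_))
  primeProduct-distinct 2≤k {suc n} distinct {true ∷ bs} {false ∷ bs′} _ =
    DistinctModPowers-prime 2≤k (p-prime n) (∤rest bs) (∤rest bs′)
    where
    ∤rest : (cs : Vec Bool n) → ¬ p n ∣ primeProduct cs
    ∤rest = primeProduct-∤ (p-prime n) (λ i<n → distinct i<n ≤-refl)
  primeProduct-distinct 2≤k {suc n} distinct {false ∷ bs} {true ∷ bs′} _ =
    DistinctModPowers-sym {k} (DistinctModPowers-prime 2≤k (p-prime n) (∤rest bs′) (∤rest bs))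
    where
    ∤rest : (cs : Vec Bool n) → ¬ p n ∣ primeProduct cs
    ∤rest = primeProduct-∤ (p-prime n) (λ i<n → distinct i<n ≤-refl)

primeFactor : ∀ n → 2 ≤ n → ∃ λ p → Prime p × p ∣ n
primeFactor n 2≤n = first (factors fac) (isFactorisation fac) (factorsPrime fac)
  where
  open PrimeFactorisation
  fac = factorise n {{>-nonZero (<-trans (s≤s z≤n) 2≤n)}}
  first : ∀ ps → n ≡ product ps → All Prime ps → ∃ λ p → Prime p × p ∣ n
  first []       n≡1 _          = contradiction (subst (1 <_) n≡1 2≤n) (<-irrefl refl)
  first (p ∷ ps) n≡  (pp ∷ _)   = p , pp , subst (p ∣_) (sym n≡) (m∣m*n (product ps))

∣n! : ∀ {i n} → 1 ≤ i → i ≤ n → i ∣ n !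
∣n! {suc i} _ i≤n = ∣-trans (m∣m*n (i !)) (m≤n⇒m!∣n! i≤n)

-- A prime factor of (j + 1) R! + 1 exceeds R; two of them for i < j ≤ R would divide (j - i) R!.
module PrimeSupply (R : ℕ) where

  seed : ℕ → ℕ
  seed j = suc j * R ! + 1

  private
    2≤seed : ∀ j → 2 ≤ seed j
    2≤seed j = subst (2 ≤_) (+-comm 1 (suc j * R !)) (s≤s (*-mono-≤ {1} {suc j} (s≤s z≤n) (1≤n! R)))

  opaque
    p : ℕ → ℕ
    p j = proj₁ (primeFactor (seed j) (2≤seed j))

    p-prime : ∀ j → Prime (p j)
    p-prime j = proj₁ (proj₂ (primeFactor (seed j) (2≤seed j)))

    p∣seed : ∀ j → p j ∣ seed j
    p∣seed j = proj₂ (proj₂ (primeFactor (seed j) (2≤seed j)))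

  p∤R! : ∀ j → ¬ p j ∣ R !
  p∤R! j p∣R! = prime∤1 (p-prime j) (∣m+n∣m⇒∣n (p∣seed j) (∣n⇒∣m*n (suc j) p∣R!))

  R<p : ∀ j → R < p j
  R<p j = ≰⇒> λ p≤R → p∤R! j (∣n! (<⇒≤ (prime⇒1< (p-prime j))) p≤R)

  p-distinct : ∀ {i j} → i < j → j ≤ R → p i ≢ p j
  p-distinct {i} {j} i<j j≤R pᵢ≡pⱼ with euclidsLemma (j ∸ i) (R !) (p-prime i) pᵢ∣[j-i]R!
    where
    seedⱼ≡ : seed j ≡ seed i + (j ∸ i) * R !
    seedⱼ≡ = trans (cong (λ x → suc x * R ! + 1) (sym (m+[n∸m]≡n (<⇒≤ i<j)))) (expand i (j ∸ i) (R !))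
      where
      expand : ∀ i d F → suc (i + d) * F + 1 ≡ suc i * F + 1 + d * F
      expand = solve-∀
    pᵢ∣[j-i]R! : p i ∣ (j ∸ i) * R !
    pᵢ∣[j-i]R! = ∣m+n∣m⇒∣n (subst (p i ∣_) seedⱼ≡ (subst (_∣ seed j) (sym pᵢ≡pⱼ) (p∣seed j))) (p∣seed i)
  ... | inj₂ pᵢ∣R!  = p∤R! i pᵢ∣R!
  ... | inj₁ pᵢ∣j-i = <⇒≱ (R<p i) (≤-trans (∣⇒≤ {{>-nonZero (m<n⇒0<n∸m i<j)}} pᵢ∣j-i) (≤-trans (m∸n≤m j i) j≤R))

  p≤2^[R+2]² : ∀ {j} → j ≤ R → p j ≤ 2 ^ ((2 + R) * (2 + R))
  p≤2^[R+2]² {j} j≤R = begin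
    p j                  ≤⟨ ∣⇒≤ {{>-nonZero (<-trans (s≤s z≤n) (2≤seed j))}} (p∣seed j) ⟩
    suc j * R ! + 1      ≤⟨ +-mono-≤ (*-monoˡ-≤ (R !) (s≤s j≤R)) (1≤n! R) ⟩
    suc R * R ! + R !    ≡⟨ +-comm (suc R * R !) (R !) ⟩
    (2 + R) * R !        ≤⟨ *-monoʳ-≤ (2 + R) (m≤n*m (R !) (suc R)) ⟩
    (2 + R) !            ≤⟨ n!≤2^[n*n] (2 + R) ⟩
    2 ^ ((2 + R) * (2 + R)) ∎
    where open ≤-Reasoning

-- Simultaneous approximation of k-th roots

module _ (k : ℕ) .{{_ : NonZero k}} where

  ^-cancelˡ-≤ : ∀ {a b} → a ^ k ≤ b ^ k → a ≤ b
  ^-cancelˡ-≤ aᵏ≤bᵏ = ≮⇒≥ λ b<a → <⇒≱ (^-monoˡ-< k b<a) aᵏ≤bᵏ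

  ^-cancelˡ-< : ∀ {a b} → a ^ k < b ^ k → a < b
  ^-cancelˡ-< aᵏ<bᵏ = ≰⇒> λ b≤a → <⇒≱ aᵏ<bᵏ (^-monoˡ-≤ k b≤a)

  ⌊root⌋ : ∀ Y → ∃ λ c → c ^ k ≤ Y × Y < suc c ^ k
  ⌊root⌋ zero = 0 , ≤-reflexive (0^k≡0 k) , m^n>0 1 k
    where
    0^k≡0 : ∀ n .{{_ : NonZero n}} → 0 ^ n ≡ 0
    0^k≡0 (suc n) = refl
  ⌊root⌋ (suc Y) with ⌊root⌋ Y
  ... | c , cᵏ≤Y , Y<[1+c]ᵏ with suc c ^ k ≤? suc Y
  ...   | yes [1+c]ᵏ≤1+Y = suc c , [1+c]ᵏ≤1+Y , ≤-<-trans Y<[1+c]ᵏ (^-monoˡ-< k (n<1+n (suc c)))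
  ...   | no  [1+c]ᵏ≰1+Y = c , m≤n⇒m≤1+n cᵏ≤Y , ≰⇒> [1+c]ᵏ≰1+Y

  root-bounds : ∀ {c D d B} → c ^ k ≤ D ^ k * d → D ^ k * d < suc c ^ k → 1 ≤ d → d ≤ B ^ k →
                D ≤ c × c ≤ D * B
  root-bounds {c} {D} {d} {B} cᵏ≤Dᵏd Dᵏd<[1+c]ᵏ 1≤d d≤Bᵏ =
    ≤-pred (^-cancelˡ-< (≤-<-trans (m≤m*n (D ^ k) d {{>-nonZero 1≤d}}) Dᵏd<[1+c]ᵏ)) ,
    ^-cancelˡ-≤ (begin
      c ^ k         ≤⟨ cᵏ≤Dᵏd ⟩
      D ^ k * d     ≤⟨ *-monoʳ-≤ (D ^ k) d≤Bᵏ ⟩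
      D ^ k * B ^ k ≡⟨ ^-distribʳ-* D B k ⟨
      (D * B) ^ k   ∎)
    where open ≤-Reasoning

  between⇒power-between : ∀ {n m c D d} → c ^ k ≤ D ^ k * d → D ^ k * d < suc c ^ k →
                          n * D < m * c × m * suc c < (2 + n) * D →
                          n ^ k < m ^ k * d × m ^ k * d < (2 + n) ^ k
  between⇒power-between {n} {m} {c} {D} {d} cᵏ≤Dᵏd Dᵏd<[1+c]ᵏ (nD<mc , m[1+c]<[2+n]D) =
    *-cancelʳ-< (D ^ k) (n ^ k) (m ^ k * d) (begin-strict
      n ^ k * D ^ k       ≡⟨ ^-distribʳ-* n D k ⟨
      (n * D) ^ k         <⟨ ^-monoˡ-< k nD<mc ⟩
      (m * c) ^ k         ≡⟨ ^-distribʳ-* m c k ⟩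
      m ^ k * c ^ k       ≤⟨ *-monoʳ-≤ (m ^ k) cᵏ≤Dᵏd ⟩
      m ^ k * (D ^ k * d) ≡⟨ rearrange (m ^ k) (D ^ k) d ⟩
      m ^ k * d * D ^ k   ∎) ,
    *-cancelʳ-< (D ^ k) (m ^ k * d) ((2 + n) ^ k) (begin-strict
      m ^ k * d * D ^ k   ≡⟨ rearrange (m ^ k) (D ^ k) d ⟨
      m ^ k * (D ^ k * d) ≤⟨ *-monoʳ-≤ (m ^ k) (<⇒≤ Dᵏd<[1+c]ᵏ) ⟩
      m ^ k * suc c ^ k   ≡⟨ ^-distribʳ-* m (suc c) k ⟨
      (m * suc c) ^ k     <⟨ ^-monoˡ-< k m[1+c]<[2+n]D ⟩
      ((2 + n) * D) ^ k   ≡⟨ ^-distribʳ-* (2 + n) D k ⟩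
      (2 + n) ^ k * D ^ k ∎)
    where
    open ≤-Reasoning
    rearrange : ∀ a b c → a * (b * c) ≡ a * c * b
    rearrange = solve-∀

near-multiple⇒between : ∀ {n m c D s} → D ≤ c → 2 * s < D → 2 * suc n ≤ D →
                         m * c ≤ suc n * D + s → suc n * D ≤ m * c + s →
                         n * D < m * c × m * suc c < (2 + n) * D
near-multiple⇒between {n} {m} {c} {D} {s} D≤c 2s<D 2N≤D mc≤ND+s ND≤mc+s =
  +-cancelˡ-< D (n * D) (m * c) (begin-strict
    suc n * D ≤⟨ ND≤mc+s ⟩
    m * c + s <⟨ +-monoʳ-< (m * c) s<D ⟩
    m * c + D ≡⟨ +-comm (m * c) D ⟩
    D + m * c ∎) ,
  (begin-strict
    m * suc c               ≡⟨ *-suc m c ⟩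
    m + m * c               ≤⟨ +-mono-≤ m≤N mc≤ND+s ⟩
    suc n + (suc n * D + s) ≡⟨ rearrange (suc n) (suc n * D) s ⟩
    (suc n + s) + suc n * D <⟨ +-monoˡ-< (suc n * D) N+s<D ⟩
    D + suc n * D           ∎)
  where
  open ≤-Reasoning
  rearrange : ∀ a b c → a + (b + c) ≡ (a + c) + b
  rearrange = solve-∀
  s<D : s < D
  s<D = ≤-<-trans (m≤m+n s (s + 0)) 2s<D
  instance
    c≢0 : NonZero c
    c≢0 = >-nonZero (≤-trans (≤-<-trans z≤n s<D) D≤c)
  m≤N : m ≤ suc n
  m≤N = ≤-pred (*-cancelʳ-< c m (2 + n) (begin-strict
    m * c             ≤⟨ mc≤ND+s ⟩
    suc n * D + s     ≤⟨ +-monoˡ-≤ s (*-monoʳ-≤ (suc n) D≤c) ⟩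
    suc n * c + s     <⟨ +-monoʳ-< (suc n * c) (<-≤-trans s<D D≤c) ⟩
    suc n * c + c     ≡⟨ +-comm (suc n * c) c ⟩
    (2 + n) * c       ∎))
  N+s<D : suc n + s < D
  N+s<D = *-cancelˡ-< 2 (suc n + s) D (begin-strict
    2 * (suc n + s)     ≡⟨ *-distribˡ-+ 2 (suc n) s ⟩
    2 * suc n + 2 * s   <⟨ +-mono-≤-< 2N≤D 2s<D ⟩
    D + D               ≡⟨ cong (D +_) (+-identityʳ D) ⟨
    2 * D               ∎)

a/c≡b/c⇒∣a-b∣<c : ∀ {a b} c .{{_ : NonZero c}} → a / c ≡ b / c → ∣ a - b ∣ < c
a/c≡b/c⇒∣a-b∣<c {a} {b} c a/c≡b/c = begin-strict
  ∣ a - b ∣                                   ≡⟨ cong₂ ∣_-_∣ (m≡m%n+[m/n]*n a c) (m≡m%n+[m/n]*n b c) ⟩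
  ∣ a % c + a / c * c - b % c + b / c * c ∣   ≡⟨ cong₂ ∣_-_∣ (+-comm (a % c) _) (cong₂ _+_ refl (cong (_* c) (sym a/c≡b/c))) ⟩
  ∣ a / c * c + a % c - b % c + a / c * c ∣   ≡⟨ cong (∣_-_∣ (a / c * c + a % c)) (+-comm (b % c) (a / c * c)) ⟩
  ∣ a / c * c + a % c - a / c * c + b % c ∣   ≡⟨ ∣m+n-m+o∣≡∣n-o∣ (a / c * c) (a % c) (b % c) ⟩
  ∣ a % c - b % c ∣                           ≤⟨ ∣m-n∣≤m⊔n (a % c) (b % c) ⟩
  a % c ⊔ b % c                               <⟨ ⊔-pres-<m (m%n<n a c) (m%n<n b c) ⟩
  c                                           ∎
  where open ≤-Reasoning

module _ (c Q : ℕ) .{{_ : NonZero c}} .{{_ : NonZero Q}} where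

  bucket : ℕ → ℕ
  bucket x = x % c * Q / c

  bucket<Q : ∀ x → bucket x < Q
  bucket<Q x = m<n*o⇒m/o<n (subst (x % c * Q <_) (*-comm c Q) (*-monoˡ-< Q (m%n<n x c)))

  same-bucket⇒near-multiple : ∀ x z → bucket x ≡ bucket (x + z) →
    ∃ λ s → s * Q < c × ((x + z) / c ∸ x / c) * c ≤ z + s × z ≤ ((x + z) / c ∸ x / c) * c + s
  same-bucket⇒near-multiple x z same = s , sQ<c , mc≤z+s , z≤mc+s
    where
    open ≤-Reasoning
    a = x % c
    b = (x + z) % c
    s = ∣ a - b ∣
    m = (x + z) / c ∸ x / c
    sQ<c : s * Q < c
    sQ<c = subst (_< c) (sym (*-distribʳ-∣-∣ Q a b)) (a/c≡b/c⇒∣a-b∣<c c same)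
    z+a≡mc+b : z + a ≡ m * c + b
    z+a≡mc+b = +-cancelˡ-≡ (x / c * c) _ _ (begin-equality
      x / c * c + (z + a)       ≡⟨ rearrange (x / c * c) z a ⟩
      (a + x / c * c) + z       ≡⟨ cong (_+ z) (m≡m%n+[m/n]*n x c) ⟨
      x + z                     ≡⟨ m≡m%n+[m/n]*n (x + z) c ⟩
      b + (x + z) / c * c       ≡⟨ cong (λ t → b + t * c) (m+[n∸m]≡n (/-monoˡ-≤ c (m≤m+n x z))) ⟨
      b + (x / c + m) * c       ≡⟨ expand b (x / c) m c ⟩
      x / c * c + (m * c + b)   ∎)
      where
      rearrange : ∀ u z a → u + (z + a) ≡ (a + u) + z
      rearrange = solve-∀
      expand : ∀ b u m c → b + (u + m) * c ≡ u * c + (m * c + b)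
      expand = solve-∀
    mc≤z+s : m * c ≤ z + s
    mc≤z+s = +-cancelʳ-≤ b (m * c) (z + s) (begin
      m * c + b     ≡⟨ z+a≡mc+b ⟨
      z + a         ≤⟨ +-monoʳ-≤ z (m≤∣m-n∣+n a b) ⟩
      z + (s + b)   ≡⟨ +-assoc z s b ⟨
      z + s + b     ∎)
    z≤mc+s : z ≤ m * c + s
    z≤mc+s = +-cancelʳ-≤ a z (m * c + s) (begin
      z + a             ≡⟨ z+a≡mc+b ⟩
      m * c + b         ≤⟨ +-monoʳ-≤ (m * c) (subst (b ≤_) (cong (_+ a) (∣-∣-comm b a)) (m≤∣m-n∣+n b a)) ⟩
      m * c + (s + a)   ≡⟨ +-assoc (m * c) s a ⟨
      m * c + s + a     ∎)

module _ (Q : ℕ) .{{_ : NonZero Q}} {A : Set} where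

  encode : (A → ℕ) → List A → ℕ
  encode f []       = 0
  encode f (a ∷ as) = f a + encode f as * Q

  encode< : ∀ {f} → (∀ a → f a < Q) → ∀ as → encode f as < Q ^ length as
  encode< f<Q []       = s≤s z≤n
  encode< {f} f<Q (a ∷ as) = begin-strict
    f a + encode f as * Q   <⟨ +-monoˡ-< (encode f as * Q) (f<Q a) ⟩
    Q + encode f as * Q     ≤⟨ *-monoˡ-≤ Q (encode< f<Q as) ⟩
    Q ^ length as * Q       ≡⟨ *-comm (Q ^ length as) Q ⟩
    Q ^ suc (length as)     ∎
    where open ≤-Reasoning

  digits-injective : ∀ {x y X Y} → x < Q → y < Q → x + X * Q ≡ y + Y * Q → x ≡ y × X ≡ Y
  digits-injective {x} {y} {X} {Y} x<Q y<Q eq = x≡y , *-cancelʳ-≡ X Y Q (+-cancelˡ-≡ x _ _ (trans eq (cong (_+ Y * Q) (sym x≡y))))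
    where
    x≡y : x ≡ y
    x≡y = begin
      x                   ≡⟨ m<n⇒m%n≡m x<Q ⟨
      x % Q               ≡⟨ [m+kn]%n≡m%n x X Q ⟨
      (x + X * Q) % Q     ≡⟨ cong (_% Q) eq ⟩
      (y + Y * Q) % Q     ≡⟨ [m+kn]%n≡m%n y Y Q ⟩
      y % Q               ≡⟨ m<n⇒m%n≡m y<Q ⟩
      y                   ∎
      where open ≡-Reasoning

  encode-injective : ∀ {f g} → (∀ a → f a < Q) → (∀ a → g a < Q) →
                     ∀ as → encode f as ≡ encode g as → All (λ a → f a ≡ g a) as
  encode-injective f<Q g<Q []       _  = []
  encode-injective f<Q g<Q (a ∷ as) eq with digits-injective (f<Q a) (g<Q a) eq
  ... | fa≡ga , rest = fa≡ga ∷ encode-injective f<Q g<Q as rest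

  pigeonhole-digits : ∀ (as : List A) (f : ℕ → A → ℕ) → (∀ j a → f j a < Q) →
                      ∃₂ λ i j → i < j × j ≤ Q ^ length as × All (λ a → f i a ≡ f j a) as
  pigeonhole-digits as f f<Q with Fin.pigeonhole (n<1+n (Q ^ length as)) box
    where
    box : Fin (suc (Q ^ length as)) → Fin (Q ^ length as)
    box j = fromℕ< (encode< (f<Q (toℕ j)) as)
  ... | i , j , i<j , boxᵢ≡boxⱼ = toℕ i , toℕ j , i<j , ≤-pred (Fin.toℕ<n j) ,
    encode-injective (f<Q (toℕ i)) (f<Q (toℕ j)) as (begin
      encode (f (toℕ i)) as ≡⟨ Fin.toℕ-fromℕ< _ ⟨
      toℕ (fromℕ< _)        ≡⟨ cong toℕ boxᵢ≡boxⱼ ⟩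
      toℕ (fromℕ< _)        ≡⟨ Fin.toℕ-fromℕ< _ ⟩
      encode (f (toℕ j)) as ∎)
    where open ≡-Reasoning

module SimultaneousApproximation
  (k : ℕ) .{{_ : NonZero k}} {A : Set} (d : A → ℕ) (1≤d : ∀ a → 1 ≤ d a)
  (B : ℕ) .{{_ : NonZero B}} (d≤Bᵏ : ∀ a → d a ≤ B ^ k) (as : List A) (T : ℕ) (1≤T : 1 ≤ T) where

  -- c a = ⌊D · (d a) ^ (1/k)⌋. Two of the points T j D (j ≤ L) share their buckets modulo every c a,
  -- and their difference N D is then close to a multiple of each c a.
  private
    Q = 2 * B
    L = Q ^ length as
    D = 2 * T * L
    instance
      Q≢0 : NonZero Q
      Q≢0 = m*n≢0 2 B
      L≢0 : NonZero L
      L≢0 = m^n≢0 Q (length as)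
    1≤D : 1 ≤ D
    1≤D = *-mono-≤ (*-mono-≤ (s≤s (z≤n {1})) 1≤T) (>-nonZero⁻¹ L)
    c : A → ℕ
    c a = proj₁ (⌊root⌋ k (D ^ k * d a))
    bounds : ∀ a → D ≤ c a × c a ≤ D * B
    bounds a = root-bounds k (proj₁ (proj₂ (⌊root⌋ k (D ^ k * d a)))) (proj₂ (proj₂ (⌊root⌋ k (D ^ k * d a))))
                             (1≤d a) (d≤Bᵏ a)
    instance
      c≢0 : ∀ {a} → NonZero (c a)
      c≢0 {a} = >-nonZero (≤-trans 1≤D (proj₁ (bounds a)))
    x : ℕ → ℕ
    x j = T * j * D

  simultaneous-approximation :
    ∃ λ n → T ≤ suc n × suc n ≤ T * (2 * B) ^ length as × ∃ λ (m : A → ℕ) →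
      All (λ a → n ^ k < m a ^ k * d a × m a ^ k * d a < (2 + n) ^ k) as
  simultaneous-approximation
    with pigeonhole-digits Q as (λ j a → bucket (c a) Q (x j)) (λ j a → bucket<Q (c a) Q (x j))
  ... | i , j , i<j , j≤L , same-buckets =
    pred N , subst (T ≤_) (sym 1+n≡N) T≤N , subst (_≤ T * L) (sym 1+n≡N) N≤TL , m , All.map in-gaps same-buckets
    where
    N = T * (j ∸ i)
    instance
      j-i≢0 : NonZero (j ∸ i)
      j-i≢0 = >-nonZero (m<n⇒0<n∸m i<j)
      N≢0 : NonZero N
      N≢0 = m*n≢0 T (j ∸ i) {{>-nonZero 1≤T}}
    1+n≡N : suc (pred N) ≡ N
    1+n≡N = suc-pred N
    T≤N : T ≤ N
    T≤N = m≤m*n T (j ∸ i)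
    N≤TL : N ≤ T * L
    N≤TL = *-monoʳ-≤ T (≤-trans (m∸n≤m j i) j≤L)
    2N≤D : 2 * N ≤ D
    2N≤D = ≤-trans (*-monoʳ-≤ 2 N≤TL) (≤-reflexive (sym (*-assoc 2 T L)))
    xⱼ≡xᵢ+ND : x j ≡ x i + N * D
    xⱼ≡xᵢ+ND = trans (cong (λ j → T * j * D) (sym (m+[n∸m]≡n (<⇒≤ i<j)))) (expand T i (j ∸ i) D)
      where
      expand : ∀ T i δ D → T * (i + δ) * D ≡ T * i * D + T * δ * D
      expand = solve-∀
    m : A → ℕ
    m a = (x i + N * D) / c a ∸ x i / c a
    in-gaps : ∀ {a} → bucket (c a) Q (x i) ≡ bucket (c a) Q (x j) →
              pred N ^ k < m a ^ k * d a × m a ^ k * d a < (2 + pred N) ^ k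
    in-gaps {a} same =
      let s , sQ<c , mc≤ND+s , ND≤mc+s =
            same-bucket⇒near-multiple (c a) Q (x i) (N * D) (trans same (cong (bucket (c a) Q) xⱼ≡xᵢ+ND))
      in between⇒power-between k cᵏ≤Dᵏd Dᵏd<[1+c]ᵏ
           (near-multiple⇒between {pred N} {m a} {c a} {D} {s} D≤c (2s<D {s} sQ<c)
             (subst (λ M → 2 * M ≤ D) (sym 1+n≡N) 2N≤D)
             (subst (λ M → m a * c a ≤ M * D + s) (sym 1+n≡N) mc≤ND+s)
             (subst (λ M → M * D ≤ m a * c a + s) (sym 1+n≡N) ND≤mc+s))
      where
      root = ⌊root⌋ k (D ^ k * d a)
      cᵏ≤Dᵏd = proj₁ (proj₂ root)
      Dᵏd<[1+c]ᵏ = proj₂ (proj₂ root)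
      D≤c = proj₁ (bounds a)
      2s<D : ∀ {s} → s * Q < c a → 2 * s < D
      2s<D {s} sQ<c = *-cancelʳ-< B (2 * s) D (begin-strict
        2 * s * B   ≡⟨ rearrange s B ⟩
        s * Q       <⟨ sQ<c ⟩
        c a         ≤⟨ proj₂ (bounds a) ⟩
        D * B       ∎)
        where
        open ≤-Reasoning
        rearrange : ∀ s B → 2 * s * B ≡ s * (2 * B)
        rearrange = solve-∀

-- Clusters of k-full numbers in consecutive gaps

subsets : ∀ n → List (Vec Bool n)
subsets zero    = [] ∷ []
subsets (suc n) = cartesianProductWith _∷_ (true ∷ false ∷ []) (subsets n)

length-subsets : ∀ n → length (subsets n) ≡ 2 ^ n
length-subsets zero    = refl
length-subsets (suc n) = begin
  length (map (true ∷_) S ++ (map (false ∷_) S ++ []))        ≡⟨ length-++ (map (true ∷_) S) ⟩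
  length (map (true ∷_) S) + length (map (false ∷_) S ++ [])  ≡⟨ cong₂ _+_ (length-map _ S) (trans (length-++ (map (false ∷_) S)) (cong (_+ 0) (length-map _ S))) ⟩
  length S + (length S + 0)                                   ≡⟨ cong (λ l → l + (l + 0)) (length-subsets n) ⟩
  2 ^ suc n                                                   ∎
  where
  open ≡-Reasoning
  S = subsets n

subsets-unique : ∀ n → Unique (subsets n)
subsets-unique zero    = [] ∷ []
subsets-unique (suc n) = Unique.cartesianProductWith⁺ _∷_ ∷-injective (((λ ()) ∷ []) ∷ [] ∷ []) (subsets-unique n)

module _ {A : Set} {P : A → Set} (P? : Decidable P) where

  length-filter+filter∁ : ∀ xs → length (filter P? xs) + length (filter (∁? P?) xs) ≡ length xs
  length-filter+filter∁ []       = refl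
  length-filter+filter∁ (x ∷ xs) with P? x
  ... | yes _ = cong suc (length-filter+filter∁ xs)
  ... | no  _ = trans (+-suc _ _) (cong suc (length-filter+filter∁ xs))

InGap : ℕ → ℕ → ℕ → Set
InGap k N v = N ^ k < v × v < suc N ^ k

InGap? : ∀ k N v → Dec (InGap k N v)
InGap? k N v = (N ^ k <? v) ×-dec (v <? suc N ^ k)

cluster-of-list : ∀ {k N H} ys → H ≤ length ys → Unique ys → All (λ v → InGap k N v × KFull k v) ys →
                  ∃ λ K → H ≤ K × Σ (Vec ℕ K) (KFullInGap k N K)
cluster-of-list {H = H} ys H≤∣ys∣ unique-ys in-gap =
  length (sort ys) , subst (H ≤_) (sym (↭-length (sort-↭ ys))) H≤∣ys∣ , fromList (sort ys) ,
  subst (Linked _<_) (sym (toList∘fromList (sort ys))) increasing ,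
  VecAll.fromList⁺ (All.map (λ ((lo , hi) , full) → lo , hi , full) (All-resp-↭ (↭-sym (sort-↭ ys)) in-gap))
  where
  unique-sorted : Unique (sort ys)
  unique-sorted = ↭ₛ.Unique-resp-↭ (setoid ℕ) (↭⇒↭ₛ (↭-sym (sort-↭ ys))) unique-ys
  increasing : Linked _<_ (sort ys)
  increasing = AllPairs⇒Linked (AllPairs.zipWith (λ (x≤y , x≢y) → ≤∧≢⇒< x≤y x≢y)
                                  (Linked⇒AllPairs ≤-trans (sort-↗ ys) , unique-sorted))

cluster-in-one-gap : ∀ {k n H} xs → H + H ≤ length xs → Unique xs →
                     All (λ v → KFull k v × (InGap k n v ⊎ InGap k (suc n) v)) xs →
                     ∃ λ N → n ≤ N × N ≤ suc n × ∃ λ K → H ≤ K × Σ (Vec ℕ K) (KFullInGap k N K)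
cluster-in-one-gap {k} {n} {H} xs 2H≤∣xs∣ unique-xs placed with H ≤? length (filter (InGap? k (suc n)) xs)
... | yes H≤∣upper∣ = suc n , n≤1+n n , ≤-refl ,
  cluster-of-list {k} {suc n} (filter P? xs) H≤∣upper∣ (Unique.filter⁺ P? unique-xs)
    (All.zipWith (λ (gap , full , _) → gap , full) (All.all-filter P? xs , All.filter⁺ P? placed))
  where
  P? = InGap? k (suc n)
... | no  H≰∣upper∣ = n , ≤-refl , n≤1+n n ,
  cluster-of-list {k} {n} lower H≤∣lower∣ (Unique.filter⁺ (∁? P?) unique-xs)
    (All.zipWith lower-gap (All.all-filter (∁? P?) xs , All.filter⁺ (∁? P?) placed))
  where
  P? = InGap? k (suc n)
  lower = filter (∁? P?) xs
  H≤∣lower∣ : H ≤ length lower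
  H≤∣lower∣ = +-cancelˡ-≤ H H (length lower) (≤-trans (≤-trans 2H≤∣xs∣
    (≤-reflexive (sym (length-filter+filter∁ P? xs)))) (+-monoˡ-≤ (length lower) (<⇒≤ (≰⇒> H≰∣upper∣))))
  lower-gap : ∀ {v} → ¬ InGap k (suc n) v × KFull k v × (InGap k n v ⊎ InGap k (suc n) v) →
              InGap k n v × KFull k v
  lower-gap (_     , full , inj₁ gap) = gap , full
  lower-gap (¬gap  , _    , inj₂ gap) = contradiction gap ¬gap

between-gaps : ∀ {k n v} → n ^ k < v → v < (2 + n) ^ k → v ≢ suc n ^ k → InGap k n v ⊎ InGap k (suc n) v
between-gaps {k} {n} {v} lo hi v≢ with <-cmp v (suc n ^ k)
... | tri< v< _ _ = inj₁ (lo , v<)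
... | tri≈ _ v≡ _ = contradiction v≡ v≢
... | tri> _ _ v> = inj₂ (v> , hi)

allPairs-mapWithAll : ∀ {A : Set} {P : A → Set} {R S : A → A → Set} →
                      (∀ {x y} → P x → P y → R x y → S x y) →
                      ∀ {xs} → All P xs → AllPairs.AllPairs R xs → AllPairs.AllPairs S xs
allPairs-mapWithAll f []         []         = []
allPairs-mapWithAll f (px ∷ pxs) (rx ∷ rxs) =
  All.zipWith (λ (py , r) → f px py r) (pxs , rx) ∷ allPairs-mapWithAll f pxs rxs

0<m^k*d⇒1≤m : ∀ {k m d} .{{_ : NonZero k}} → 0 < m ^ k * d → 1 ≤ m
0<m^k*d⇒1≤m {suc k} {zero} ()
0<m^k*d⇒1≤m {suc k} {suc m} _ = s≤s z≤n

module KFullCluster {k : ℕ} (2≤k : 2 ≤ k) {T : ℕ} (1≤T : 1 ≤ T) {r′ : ℕ} (T≤r′ : T ≤ r′) (13≤r′ : 13 ≤ r′) where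

  -- The primes p 0, …, p r are at most 2 ^ α, so d S ≤ B ^ k; 2 + β ≤ H then yields N ≤ 2 ^ (2 H²).
  private
    r  = suc r′
    H  = 2 ^ r′
    α  = (2 + r) * (2 + r)
    β  = 2 * α * suc r
    B  = 2 ^ β

    instance
      k≢0 : NonZero k
      k≢0 = >-nonZero (≤-trans (s≤s z≤n) 2≤k)
      2^α≢0 : NonZero (2 ^ α)
      2^α≢0 = m^n≢0 2 α

    open PrimeSupply r
    open PrimeProducts k p p-prime

    d : Vec Bool r → ℕ
    d S = primeProduct (true ∷ S)

    1≤d : ∀ S → 1 ≤ d S
    1≤d S = proj₁ (primeProduct-KFull (true ∷ S))

    d≤Bᵏ : ∀ S → d S ≤ B ^ k
    d≤Bᵏ S = begin
      d S                        ≤⟨ primeProduct-≤ (λ i<1+r → p≤2^[R+2]² (≤-pred i<1+r)) (true ∷ S) ⟩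
      (2 ^ α) ^ (suc k * suc r)  ≡⟨ ^-*-assoc 2 α (suc k * suc r) ⟩
      2 ^ (α * (suc k * suc r))  ≤⟨ ^-monoʳ-≤ 2 exponent ⟩
      2 ^ (β * k)                ≡⟨ ^-*-assoc 2 β k ⟨
      B ^ k                      ∎
      where
      open ≤-Reasoning
      exponent : α * (suc k * suc r) ≤ β * k
      exponent = begin
        α * (suc k * suc r)   ≡⟨ regroup α (suc k) (suc r) ⟩
        α * suc r * suc k     ≤⟨ *-monoʳ-≤ (α * suc r) (+-monoˡ-≤ k (≤-trans (s≤s z≤n) 2≤k)) ⟩
        α * suc r * (k + k)   ≡⟨ regroup′ α (suc r) k ⟩
        β * k                 ∎
        where
        regroup : ∀ a b c → a * (b * c) ≡ a * c * b
        regroup = solve-∀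
        regroup′ : ∀ a b c → a * b * (c + c) ≡ 2 * a * b * c
        regroup′ = solve-∀

    d-distinct : ∀ {S S′} → S ≢ S′ → DistinctModPowers k (d S) (d S′)
    d-distinct {S} {S′} S≢S′ =
      primeProduct-distinct 2≤k (λ i<j j<1+r → p-distinct i<j (≤-pred j<1+r)) {true ∷ S} {true ∷ S′}
        (S≢S′ ∘ proj₂ ∘ ∷-injective)

    d-not-power : ∀ S → DistinctModPowers k (d S) 1
    d-not-power S = DistinctModPowers-prime 2≤k (p-prime r)
      (primeProduct-∤ (p-prime r) (λ i<r → p-distinct i<r ≤-refl) S) (prime∤1 (p-prime r))

    values : (Vec Bool r → ℕ) → List ℕ
    values m = map (λ S → m S ^ k * d S) (subsets r)

    values-cluster : ∀ {n} (m : Vec Bool r → ℕ) →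
      All (λ S → n ^ k < m S ^ k * d S × m S ^ k * d S < (2 + n) ^ k) (subsets r) →
      ∃ λ N → n ≤ N × N ≤ suc n × ∃ λ K → H ≤ K × Σ (Vec ℕ K) (KFullInGap k N K)
    values-cluster {n} m in-gaps = cluster-in-one-gap {k} {n} {H} (values m) 2H≤∣values∣ unique placed
      where
      1≤m : All (λ S → 1 ≤ m S) (subsets r)
      1≤m = All.map (λ {S} (lo , _) → 0<m^k*d⇒1≤m {k} {m S} {d S} (≤-<-trans z≤n lo)) in-gaps
      unique : Unique (values m)
      unique = AllPairs.map⁺ (allPairs-mapWithAll (λ 1≤mS 1≤mS′ S≢S′ → d-distinct S≢S′ 1≤mS 1≤mS′) 1≤m (subsets-unique r))
      place : ∀ {S} → (n ^ k < m S ^ k * d S × m S ^ k * d S < (2 + n) ^ k) × 1 ≤ m S →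
              KFull k (m S ^ k * d S) × (InGap k n (m S ^ k * d S) ⊎ InGap k (suc n) (m S ^ k * d S))
      place {S} ((lo , hi) , 1≤mS) =
        KFull-* {k} (KFull-^ {k} 1≤mS ≤-refl) (primeProduct-KFull (true ∷ S)) ,
        between-gaps {k} {n} lo hi λ eq → d-not-power S 1≤mS (s≤s z≤n) (trans eq (sym (*-identityʳ (suc n ^ k))))
      placed : All (λ v → KFull k v × (InGap k n v ⊎ InGap k (suc n) v)) (values m)
      placed = All.map⁺ (All.zipWith place (in-gaps , 1≤m))
      2H≤∣values∣ : H + H ≤ length (values m)
      2H≤∣values∣ = ≤-reflexive (sym (trans (length-map _ (subsets r))
                                     (trans (length-subsets r) (cong (H +_) (+-identityʳ H)))))

    2+β≤H : 2 + β ≤ H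
    2+β≤H = begin
      2 + 2 * (y * y) * suc r              ≤⟨ +-monoˡ-≤ (2 * (y * y) * suc r) (*-monoʳ-≤ 2 (*-mono-≤ {1} {y} {1} {y} (s≤s z≤n) (s≤s z≤n))) ⟩
      2 * (y * y) + 2 * (y * y) * suc r    ≡⟨ cube-split r′ ⟩
      2 * (y * y * y)                      ≤⟨ 2*[3+x]³≤2^x 13≤r′ ⟩
      H                                    ∎
      where
      open ≤-Reasoning
      y = 3 + r′
      cube-split : ∀ x → 2 * ((3 + x) * (3 + x)) + 2 * ((3 + x) * (3 + x)) * (2 + x)
                         ≡ 2 * ((3 + x) * (3 + x) * (3 + x))
      cube-split = solve-∀

    N≤2^[2K²] : ∀ {n N K} → N ≤ suc n → suc n ≤ T * (2 * B) ^ length (subsets r) → H ≤ K →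
                N ≤ 2 ^ (2 * (K * K))
    N≤2^[2K²] {n} {N} {K} N≤1+n 1+n≤TQᴹ H≤K = begin
      N                           ≤⟨ ≤-trans N≤1+n 1+n≤TQᴹ ⟩
      T * (2 * B) ^ length (subsets r) ≡⟨ cong (λ l → T * (2 * B) ^ l) (length-subsets r) ⟩
      T * (2 * B) ^ M             ≤⟨ *-monoˡ-≤ ((2 * B) ^ M) T≤2^M ⟩
      2 ^ M * (2 ^ suc β) ^ M     ≡⟨ cong (2 ^ M *_) (^-*-assoc 2 (suc β) M) ⟩
      2 ^ M * 2 ^ (suc β * M)     ≡⟨ ^-distribˡ-+-* 2 M (suc β * M) ⟨
      2 ^ ((2 + β) * M)           ≤⟨ ^-monoʳ-≤ 2 (*-monoˡ-≤ M 2+β≤H) ⟩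
      2 ^ (H * (2 * H))           ≡⟨ cong (2 ^_) (regroup H) ⟩
      2 ^ (2 * (H * H))           ≤⟨ ^-monoʳ-≤ 2 (*-monoʳ-≤ 2 (*-mono-≤ H≤K H≤K)) ⟩
      2 ^ (2 * (K * K))           ∎
      where
      open ≤-Reasoning
      M = 2 ^ r
      T≤2^M : T ≤ 2 ^ M
      T≤2^M = ≤-trans T≤r′ (≤-trans (<⇒≤ (n<2^n r′)) (≤-trans (^-monoʳ-≤ 2 (n≤1+n r′)) (<⇒≤ (n<2^n M))))
      regroup : ∀ h → h * (2 * h) ≡ 2 * (h * h)
      regroup = solve-∀

  opaque
    kfull-cluster : ∃ λ N → T ≤ suc N × ∃ λ K → 1 ≤ K × N ≤ 2 ^ (2 * (K * K)) × Σ (Vec ℕ K) (KFullInGap k N K)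
    kfull-cluster =
      let n , T≤1+n , 1+n≤TQᴹ , m , in-gaps =
            SimultaneousApproximation.simultaneous-approximation k d 1≤d B {{m^n≢0 2 β}} d≤Bᵏ (subsets r) T 1≤T
          N , n≤N , N≤1+n , K , H≤K , cluster = values-cluster m in-gaps
      in N , ≤-trans T≤1+n (s≤s n≤N) , K , ≤-trans (m^n>0 2 r′) H≤K , N≤2^[2K²] {n} {N} {K} N≤1+n 1+n≤TQᴹ H≤K , cluster

-- The logarithmic bound

ℕ→ℚ≡mkℚ : ∀ n → ℕ→ℚ n ≡ mkℚ (ℤ.+ n) 0 (Coprime.sym (Coprime.1-coprimeTo n))
ℕ→ℚ≡mkℚ n = ℚ.↥p/↧p≡p _

ℕ→ℚ-* : ∀ m n → ℕ→ℚ (m * n) ≡ ℕ→ℚ m ℚ.* ℕ→ℚ n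
ℕ→ℚ-* m n rewrite ℕ→ℚ≡mkℚ m | ℕ→ℚ≡mkℚ n = cong (ℚ._/ 1) (ℤ.pos-* m n)

ℕ→ℚ-^ : ∀ m n → ℕ→ℚ (m ^ n) ≡ ℕ→ℚ m ^ℚ n
ℕ→ℚ-^ m zero    = refl
ℕ→ℚ-^ m (suc n) = trans (ℕ→ℚ-* m (m ^ n)) (cong (ℕ→ℚ m ℚ.*_) (ℕ→ℚ-^ m n))

ℕ→ℚ-mono-≤ : ∀ {m n} → m ≤ n → ℕ→ℚ m ℚ.≤ ℕ→ℚ n
ℕ→ℚ-mono-≤ {m} {n} m≤n rewrite ℕ→ℚ≡mkℚ m | ℕ→ℚ≡mkℚ n =
  *≤* (subst₂ ℤ._≤_ (sym (ℤ.*-identityʳ _)) (sym (ℤ.*-identityʳ _)) (ℤ.+≤+ m≤n))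

*-nonNeg : ∀ {r s} → 0ℚ ℚ.≤ r → 0ℚ ℚ.≤ s → 0ℚ ℚ.≤ r ℚ.* s
*-nonNeg {r} {s} 0≤r 0≤s = ℚ.nonNegative⁻¹ _
  {{ℚ.nonNeg*nonNeg⇒nonNeg r {{ℚ.nonNegative 0≤r}} s {{ℚ.nonNegative 0≤s}}}}

*-mono-≤-nonNeg : ∀ {r s t u} → 0ℚ ℚ.≤ r → 0ℚ ℚ.≤ t → r ℚ.≤ s → t ℚ.≤ u → r ℚ.* t ℚ.≤ s ℚ.* u
*-mono-≤-nonNeg {r} {s} {t} {u} 0≤r 0≤t r≤s t≤u = ℚ.≤-trans
  (ℚ.*-monoʳ-≤-nonNeg t {{ℚ.nonNegative 0≤t}} r≤s)
  (ℚ.*-monoˡ-≤-nonNeg s {{ℚ.nonNegative (ℚ.≤-trans 0≤r r≤s)}} t≤u)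

^ℚ-nonNeg : ∀ {r} n → 0ℚ ℚ.≤ r → 0ℚ ℚ.≤ r ^ℚ n
^ℚ-nonNeg zero    _   = ℚ.≤ᵇ⇒≤ tt
^ℚ-nonNeg (suc n) 0≤r = *-nonNeg 0≤r (^ℚ-nonNeg n 0≤r)

^ℚ-pos : ∀ {r} n → 0ℚ ℚ.< r → 0ℚ ℚ.< r ^ℚ n
^ℚ-pos zero    _   = ℚ.positive⁻¹ 1ℚ
^ℚ-pos {r} (suc n) 0<r = ℚ.positive⁻¹ _
  {{ℚ.pos*pos⇒pos r {{ℚ.positive 0<r}} _ {{ℚ.positive (^ℚ-pos n 0<r)}}}}

^ℚ-monoˡ-≤ : ∀ {r s} n → 0ℚ ℚ.≤ r → r ℚ.≤ s → r ^ℚ n ℚ.≤ s ^ℚ n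
^ℚ-monoˡ-≤ zero    _   _   = ℚ.≤-refl
^ℚ-monoˡ-≤ (suc n) 0≤r r≤s = *-mono-≤-nonNeg 0≤r (^ℚ-nonNeg n 0≤r) r≤s (^ℚ-monoˡ-≤ n 0≤r r≤s)

^ℚ-monoˡ-< : ∀ {r s} n .{{_ : NonZero n}} → 0ℚ ℚ.≤ r → r ℚ.< s → r ^ℚ n ℚ.< s ^ℚ n
^ℚ-monoˡ-< {r} {s} (suc n) 0≤r r<s = ℚ.≤-<-trans
  (ℚ.*-monoˡ-≤-nonNeg r {{ℚ.nonNegative 0≤r}} (^ℚ-monoˡ-≤ n 0≤r (ℚ.<⇒≤ r<s)))
  (ℚ.*-monoˡ-<-pos (s ^ℚ n) {{ℚ.positive (^ℚ-pos n (ℚ.≤-<-trans 0≤r r<s))}} r<s)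

^ℚ-monoʳ-≤ : ∀ {r m n} → 1ℚ ℚ.≤ r → m ≤ n → r ^ℚ m ℚ.≤ r ^ℚ n
^ℚ-monoʳ-≤ {r} {m} {n} 1≤r m≤n = subst (λ e → r ^ℚ m ℚ.≤ r ^ℚ e) (m∸n+n≡m m≤n) (grow (n ∸ m))
  where
  0≤r : 0ℚ ℚ.≤ r
  0≤r = ℚ.≤-trans (ℚ.≤ᵇ⇒≤ tt) 1≤r
  grow : ∀ d → r ^ℚ m ℚ.≤ r ^ℚ (d + m)
  grow zero    = ℚ.≤-refl
  grow (suc d) = ℚ.≤-trans (grow d) (ℚ.≤-trans (ℚ.≤-reflexive (sym (ℚ.*-identityˡ _)))
    (ℚ.*-monoʳ-≤-nonNeg (r ^ℚ (d + m)) {{ℚ.nonNegative (^ℚ-nonNeg (d + m) 0≤r)}} 1≤r))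

1/[1+n]-nonNeg : ∀ n → 0ℚ ℚ.≤ ℤ.+ 1 ℚ./ suc n
1/[1+n]-nonNeg n = ℚ.nonNegative⁻¹ _ {{ℚ.normalize-nonNeg 1 (suc n)}}

expTerm-nonNeg : ∀ {r} n → 0ℚ ℚ.≤ r → 0ℚ ℚ.≤ expTerm r n
expTerm-nonNeg zero    _   = ℚ.≤ᵇ⇒≤ tt
expTerm-nonNeg (suc n) 0≤r = *-nonNeg (expTerm-nonNeg n 0≤r) (*-nonNeg 0≤r (1/[1+n]-nonNeg n))

expTerm-monoˡ-≤ : ∀ {r s} n → 0ℚ ℚ.≤ r → r ℚ.≤ s → expTerm r n ℚ.≤ expTerm s n
expTerm-monoˡ-≤ zero    _   _   = ℚ.≤-refl
expTerm-monoˡ-≤ (suc n) 0≤r r≤s = *-mono-≤-nonNeg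
  (expTerm-nonNeg n 0≤r) (*-nonNeg 0≤r (1/[1+n]-nonNeg n))
  (expTerm-monoˡ-≤ n 0≤r r≤s) (ℚ.*-monoʳ-≤-nonNeg _ {{ℚ.normalize-nonNeg 1 (suc n)}} r≤s)

expPartial-monoˡ-≤ : ∀ {r s} n → 0ℚ ℚ.≤ r → r ℚ.≤ s → expPartial r n ℚ.≤ expPartial s n
expPartial-monoˡ-≤ zero    _   _   = ℚ.≤-refl
expPartial-monoˡ-≤ (suc n) 0≤r r≤s =
  ℚ.+-mono-≤ (expPartial-monoˡ-≤ n 0≤r r≤s) (expTerm-monoˡ-≤ (suc n) 0≤r r≤s)

2ℚ : ℚ
2ℚ = ℕ→ℚ 2

0≤2ℚ : 0ℚ ℚ.≤ 2ℚ
0≤2ℚ = ℚ.≤ᵇ⇒≤ tt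

1/[1+n]≤¼ : ∀ {n} → 3 ≤ n → ℤ.+ 1 ℚ./ suc n ℚ.≤ ℤ.+ 1 ℚ./ 4
1/[1+n]≤¼ {n} 3≤n rewrite ℚ.↥p/↧p≡p (mkℚ (ℤ.+ 1) n (Coprime.1-coprimeTo (suc n))) =
  *≤* (subst₂ ℤ._≤_ (sym (ℤ.*-identityˡ _)) (sym (ℤ.*-identityˡ _)) (ℤ.+≤+ (s≤s 3≤n)))

expTerm-2ℚ-halves : ∀ {n} → 3 ≤ n → expTerm 2ℚ (suc n) ℚ.≤ expTerm 2ℚ n ℚ.* ℚ.½
expTerm-2ℚ-halves {n} 3≤n = ℚ.*-monoˡ-≤-nonNeg (expTerm 2ℚ n) {{ℚ.nonNegative (expTerm-nonNeg n 0≤2ℚ)}}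
  (ℚ.≤-trans (ℚ.*-monoˡ-≤-nonNeg 2ℚ (1/[1+n]≤¼ 3≤n)) (ℚ.≤ᵇ⇒≤ tt))

-- Terms at least halve from n = 3 on, so a partial sum plus its last term bounds all later ones.
expPartial+expTerm-2ℚ-antitone : ∀ {n} → 3 ≤ n →
  expPartial 2ℚ (suc n) ℚ.+ expTerm 2ℚ (suc n) ℚ.≤ expPartial 2ℚ n ℚ.+ expTerm 2ℚ n
expPartial+expTerm-2ℚ-antitone {n} 3≤n = begin
  (S ℚ.+ T′) ℚ.+ T′        ≡⟨ ℚ.+-assoc S T′ T′ ⟩
  S ℚ.+ (T′ ℚ.+ T′)        ≤⟨ ℚ.+-monoʳ-≤ S (ℚ.+-mono-≤ (expTerm-2ℚ-halves 3≤n) (expTerm-2ℚ-halves 3≤n)) ⟩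
  S ℚ.+ (T ℚ.* ℚ.½ ℚ.+ T ℚ.* ℚ.½) ≡⟨ cong (S ℚ.+_) (trans (sym (ℚ.*-distribˡ-+ T ℚ.½ ℚ.½)) (ℚ.*-identityʳ T)) ⟩
  S ℚ.+ T                  ∎
  where
  open ℚ.≤-Reasoning
  S = expPartial 2ℚ n
  T = expTerm 2ℚ n
  T′ = expTerm 2ℚ (suc n)

expPartial-2ℚ≤8 : ∀ n → expPartial 2ℚ n ℚ.≤ ℕ→ℚ 8
expPartial-2ℚ≤8 0 = ℚ.≤ᵇ⇒≤ tt
expPartial-2ℚ≤8 1 = ℚ.≤ᵇ⇒≤ tt
expPartial-2ℚ≤8 2 = ℚ.≤ᵇ⇒≤ tt
expPartial-2ℚ≤8 (suc (suc (suc d))) = begin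
  S (3 + d)             ≡⟨ ℚ.+-identityʳ (S (3 + d)) ⟨
  S (3 + d) ℚ.+ 0ℚ      ≤⟨ ℚ.+-monoʳ-≤ (S (3 + d)) (expTerm-nonNeg (3 + d) 0≤2ℚ) ⟩
  S (3 + d) ℚ.+ T (3 + d) ≤⟨ descend d ⟩
  S 3 ℚ.+ T 3           ≤⟨ ℚ.≤ᵇ⇒≤ tt ⟩
  ℕ→ℚ 8                 ∎
  where
  open ℚ.≤-Reasoning
  S T : ℕ → ℚ
  S = expPartial 2ℚ
  T = expTerm 2ℚ
  descend : ∀ d → S (3 + d) ℚ.+ T (3 + d) ℚ.≤ S 3 ℚ.+ T 3
  descend zero    = ℚ.≤-refl
  descend (suc d) = ℚ.≤-trans (expPartial+expTerm-2ℚ-antitone (m≤m+n 3 d)) (descend d)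

-- r ^ (q M²) ≤ N ^ p ≤ 2 ^ (p E) forces r ≤ 2, and every partial sum of e² is below 8.
N≤2^E⇒LogBound : ∀ {p q N M E} → 8 ≤ N → N ≤ 2 ^ E → p * E ≤ q * M * M → 1 ≤ q * M * M →
           LogBound p q N M
N≤2^E⇒LogBound {p} {q} {N} {M} {E} 8≤N N≤2^E pE≤e 1≤e r 0≤r rᵉ≤Nᵖ n with r ℚ.≤? 2ℚ
... | yes r≤2 = ℚ.≤-trans (expPartial-monoˡ-≤ n 0≤r r≤2)
                          (ℚ.≤-trans (expPartial-2ℚ≤8 n) (ℕ→ℚ-mono-≤ 8≤N))
... | no  r≰2 = contradiction (ℚ.<-≤-trans Nᵖ<rᵉ rᵉ≤Nᵖ) (ℚ.<-irrefl refl)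
  where
  open ℚ.≤-Reasoning
  e = q * M * M
  instance
    e≢0 : NonZero e
    e≢0 = >-nonZero 1≤e
  Nᵖ<rᵉ : ℕ→ℚ (N ^ p) ℚ.< r ^ℚ e
  Nᵖ<rᵉ = begin-strict
    ℕ→ℚ (N ^ p)         ≤⟨ ℕ→ℚ-mono-≤ (^-monoˡ-≤ p N≤2^E) ⟩
    ℕ→ℚ ((2 ^ E) ^ p)   ≡⟨ cong ℕ→ℚ (trans (^-*-assoc 2 E p) (cong (2 ^_) (*-comm E p))) ⟩
    ℕ→ℚ (2 ^ (p * E))   ≡⟨ ℕ→ℚ-^ 2 (p * E) ⟩
    2ℚ ^ℚ (p * E)      ≤⟨ ^ℚ-monoʳ-≤ (ℚ.≤ᵇ⇒≤ tt) pE≤e ⟩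
    2ℚ ^ℚ e            <⟨ ^ℚ-monoˡ-< e 0≤2ℚ (ℚ.≰⇒> r≰2) ⟩
    r ^ℚ e              ∎

2[k+1]p<kq⇒2p<q : ∀ {k p q} → 2 * suc k * p < k * q → 2 * p < q
2[k+1]p<kq⇒2p<q {k} {p} {q} 2[k+1]p<kq = *-cancelˡ-< k (2 * p) q (begin-strict
  k * (2 * p)         ≤⟨ m≤n+m (k * (2 * p)) (2 * p) ⟩
  2 * p + k * (2 * p) ≡⟨ expand k p ⟩
  2 * suc k * p       <⟨ 2[k+1]p<kq ⟩
  k * q               ∎)
  where
  open ≤-Reasoning
  expand : ∀ k p → 2 * p + k * (2 * p) ≡ 2 * suc k * p
  expand = solve-∀

2p≤q⇒p*2M²≤qM² : ∀ {p q} → 2 * p ≤ q → ∀ M → p * (2 * (M * M)) ≤ q * M * M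
2p≤q⇒p*2M²≤qM² {p} {q} 2p≤q M = begin
  p * (2 * (M * M)) ≡⟨ regroup p (M * M) ⟩
  2 * p * (M * M)   ≤⟨ *-monoˡ-≤ (M * M) 2p≤q ⟩
  q * (M * M)       ≡⟨ *-assoc q M M ⟨
  q * M * M         ∎
  where
  open ≤-Reasoning
  regroup : ∀ p x → p * (2 * x) ≡ 2 * p * x
  regroup = solve-∀

theoremA1 : (k : ℕ) → 2 ≤ k →
    (p q : ℕ) → 1 ≤ p → 1 ≤ q → 2 * (suc k) * p < k * q →
    (N₀ : ℕ) → Σ ℕ λ N → N₀ ≤ N × 3 ≤ N ×
      Σ ℕ λ M → Σ (Vec ℕ M) λ v → KFullInGap k N M v × LogBound p q N M
theoremA1 k 2≤k p q _ 1≤q 2[k+1]p<kq N₀ =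
  let N , 9+N₀≤1+N , K , 1≤K , N≤2^[2K²] , v , cluster =
        KFullCluster.kfull-cluster 2≤k {T = 9 + N₀} (s≤s z≤n) {r′ = 22 + N₀} (m≤n+m _ 13) (m≤m+n 13 _)
      8+N₀≤N = ≤-pred 9+N₀≤1+N
  in N , ≤-trans (m≤n+m N₀ 8) 8+N₀≤N , ≤-trans (m≤m+n 3 (5 + N₀)) 8+N₀≤N , K , v , cluster ,
     N≤2^E⇒LogBound {p} {q} {N} {K} {2 * (K * K)} (≤-trans (m≤m+n 8 N₀) 8+N₀≤N) N≤2^[2K²]
       (2p≤q⇒p*2M²≤qM² {p} (<⇒≤ (2[k+1]p<kq⇒2p<q {k} {p} {q} 2[k+1]p<kq)) K) (*-mono-≤ (*-mono-≤ 1≤q 1≤K) 1≤K)
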